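{- Let $A$ be a set of actions containing $\tau$, $(S,\to)$ a labelled transition system with labels from $A$, and $R$ a binary relation on $S$. If $R$ satisfies (T), then so does its stuttering closure $\hat R$.
   Context: $s\xrightarrow{a}s'$ means $(s,a,s')\in\to$; $s\xrightarrow{(a)}s'$ means "$s\xrightarrow{a}s'$, or ($a=\tau$ and $s=s'$)"; $\twoheadrightarrow$ is the reflexive–transitive closure of $\xrightarrow{\tau}$. (T) for a relation $R$: if $sRt$ and $s\xrightarrow{a}s'$, then there are $t'',t'$ with $t\twoheadrightarrow t''\xrightarrow{(a)}t'$, $sRt''$ and $s'Rt'$. The stuttering closure of $R$ is $\hat R=\{(s,t)\mid\exists s^-,s^+,t^-,t^+\in S.\ s^-\twoheadrightarrow s\twoheadrightarrow s^+,\ t^-\twoheadrightarrow t\twoheadrightarrow t^+,\ s^-Rt^+,\ s^+Rt^-\}$. -}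

module Defs where

open import Data.Product using (Σ; ∃; ∃-syntax; _×_; _,_)
open import Data.Sum using (_⊎_)
open import Relation.Binary.PropositionalEquality using (_≡_)
open import Relation.Binary.Construct.Closure.ReflexiveTransitive using (Star)

record LTS (A : Set) (τ : A) : Set₁ where
  field
    State : Set
    _⟶[_]_ : State → A → State → Set

module _ {A : Set} {τ : A} (L : LTS A τ) where
  open LTS L

  _⟶τ_ : State → State → Set
  s ⟶τ s' = s ⟶[ τ ] s'

  _↠_ : State → State → Set
  _↠_ = Star _⟶τ_

  _⟶⟨_⟩_ : State → A → State → Set
  s ⟶⟨ a ⟩ s' = (s ⟶[ a ] s') ⊎ (a ≡ τ × s ≡ s')

  T : (State → State → Set) → Set
  T R = ∀ {s t s' a} → R s t → s ⟶[ a ] s' →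
        ∃[ t'' ] ∃[ t' ] (t ↠ t'' × t'' ⟶⟨ a ⟩ t' × R s t'' × R s' t')

  stutter : (State → State → Set) → State → State → Set
  stutter R s t = ∃[ s⁻ ] ∃[ s⁺ ] ∃[ t⁻ ] ∃[ t⁺ ]
    (s⁻ ↠ s × s ↠ s⁺ × t⁻ ↠ t × t ↠ t⁺ × R s⁻ t⁺ × R s⁺ t⁻)

module Submission where

-- By (T), R transfers τ-paths: pushing s⁻ ↠ s along s⁻ R t⁺ gives t⁺ ↠ u with s R u, and (T)
-- then matches the step of s from u. The matching state u'' is reachable from t, so s stutters
-- u'' with the old s⁺ R t⁻ as the lower witness; the targets are R-related outright.

open import Defs
open import Data.Product using (∃-syntax; _×_; _,_)
open import Data.Sum using (inj₁; inj₂)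
open import Relation.Binary.PropositionalEquality using (refl)
open import Relation.Binary.Construct.Closure.ReflexiveTransitive using (ε; _◅_; _◅◅_)

module _ {A : Set} {τ : A} (L : LTS A τ) where
  open LTS L

  ⟶⟨τ⟩⇒↠ : ∀ {x y} → _⟶⟨_⟩_ L x τ y → _↠_ L x y
  ⟶⟨τ⟩⇒↠ (inj₁ x⟶y)        = x⟶y ◅ ε
  ⟶⟨τ⟩⇒↠ (inj₂ (_ , refl)) = ε

  R⊆stutter : ∀ {R : State → State → Set} {s t} → R s t → stutter L R s t
  R⊆stutter {s = s} {t} sRt = s , s , t , t , ε , ε , ε , ε , sRt , sRt

  T⇒↠-transfer : ∀ {R : State → State → Set} → T L R →
                 ∀ {s s' t} → R s t → _↠_ L s s' → ∃[ t' ] (_↠_ L t t' × R s' t')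
  T⇒↠-transfer hT {t = t} sRt ε = t , ε , sRt
  T⇒↠-transfer hT sRt (s⟶τ ◅ s↠) with hT sRt s⟶τ
  ... | _ , _ , t↠ , t⟶⟨τ⟩ , _ , s₁Rt₁ with T⇒↠-transfer hT s₁Rt₁ s↠
  ... | t' , t₁↠t' , s'Rt' = t' , t↠ ◅◅ ⟶⟨τ⟩⇒↠ t⟶⟨τ⟩ ◅◅ t₁↠t' , s'Rt'

lemma9 : {A : Set} {τ : A} (L : LTS A τ) (R : LTS.State L → LTS.State L → Set) →
         T L R → T L (stutter L R)
lemma9 L R hT {s} (s⁻ , s⁺ , t⁻ , t⁺ , s⁻↠s , s↠s⁺ , t⁻↠t , t↠t⁺ , s⁻Rt⁺ , s⁺Rt⁻) s⟶s'
  with T⇒↠-transfer L hT s⁻Rt⁺ s⁻↠s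
... | u , t⁺↠u , sRu with hT sRu s⟶s'
... | u'' , u' , u↠u'' , u''⟶⟨a⟩u' , sRu'' , s'Ru' =
  u'' , u' , t↠u'' , u''⟶⟨a⟩u' ,
  (s , s⁺ , t⁻ , u'' , ε , s↠s⁺ , t⁻↠t ◅◅ t↠u'' , ε , sRu'' , s⁺Rt⁻) ,
  R⊆stutter L s'Ru'
  where
  t↠u'' : _↠_ L _ u''
  t↠u'' = t↠t⁺ ◅◅ t⁺↠u ◅◅ u↠u''
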